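{- Let $G$ be a graph and let $S$ be a dual general position set of $G$. If $x$ is the central vertex of an induced subgraph of $G$ isomorphic to $K_{1,3}$, then $x\notin S$.
   Context: For $S\subseteq V(G)$, two vertices $u,v$ are $S$-positionable if every shortest $u,v$-path $P$ satisfies $V(P)\cap S\subseteq\{u,v\}$. $S$ is a general position set if every two vertices of $S$ are $S$-positionable, and a dual general position set if it is a general position set and every two vertices of $V(G)\setminus S$ are $S$-positionable. -}

module Defs where

open import Data.Nat using (ℕ; zero; suc; _≤_)
open import Data.Fin using (Fin; zero; suc)
open import Data.Product using (_×_; Σ; _,_)
open import Data.Sum using (_⊎_)
open import Data.Empty using (⊥)
open import Data.Unit using (⊤)
open import Relation.Nullary using (¬_)
open import Relation.Binary.PropositionalEquality using (_≡_; _≢_)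
open import Function.Bundles using (_⇔_)
open import Function.Definitions using (Injective)

record Graph (n : ℕ) : Set₁ where
  field
    Adj   : Fin n → Fin n → Set
    sym   : ∀ {u v} → Adj u v → Adj v u
    irrefl : ∀ {u} → ¬ Adj u u
open Graph public

data Walk {n : ℕ} (G : Graph n) : Fin n → Fin n → ℕ → Set where
  [_]  : (u : Fin n) → Walk G u u zero
  _∷_  : ∀ {u w v k} → Adj G u w → Walk G w v k → Walk G u v (suc k)

data _∈W_ {n : ℕ} {G : Graph n} (x : Fin n) : ∀ {u v k} → Walk G u v k → Set where
  here-nil : x ∈W [ x ]
  here     : ∀ {w v k} (e : Adj G x w) (P : Walk G w v k) → x ∈W (e ∷ P)
  there    : ∀ {u w v k} (e : Adj G u w) {P : Walk G w v k} → x ∈W P → x ∈W (e ∷ P)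

-- a shortest u,v-path: a u,v-walk of minimum length (automatically a path)
IsShortest : ∀ {n} {G : Graph n} {u v k} → Walk G u v k → Set
IsShortest {G = G} {u} {v} {k} _ = ∀ k′ → Walk G u v k′ → k ≤ k′

VSet : ℕ → Set₁
VSet n = Fin n → Set

Positionable : ∀ {n} (G : Graph n) (S : VSet n) (u v : Fin n) → Set
Positionable G S u v =
  ∀ k (P : Walk G u v k) → IsShortest P →
  ∀ w → w ∈W P → S w → (w ≡ u) ⊎ (w ≡ v)

IsGeneralPosition : ∀ {n} (G : Graph n) (S : VSet n) → Set
IsGeneralPosition G S =
  ∀ u v → u ≢ v → S u → S v → Positionable G S u v

IsDualGeneralPosition : ∀ {n} (G : Graph n) (S : VSet n) → Set
IsDualGeneralPosition G S =
  IsGeneralPosition G S ×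
  (∀ u v → u ≢ v → ¬ S u → ¬ S v → Positionable G S u v)

K13-Adj : Fin 4 → Fin 4 → Set
K13-Adj zero zero = ⊥
K13-Adj zero (suc _) = ⊤
K13-Adj (suc _) zero = ⊤
K13-Adj (suc _) (suc _) = ⊥

record InducedK13 {n : ℕ} (G : Graph n) : Set where
  field
    f     : Fin 4 → Fin n
    inj   : Injective _≡_ _≡_ f
    pres  : ∀ i j → Adj G (f i) (f j) ⇔ K13-Adj i j

IsK13Centre : ∀ {n} (G : Graph n) → Fin n → Set
IsK13Centre G x = Σ (InducedK13 G) (λ H → InducedK13.f H zero ≡ x)

{-# OPTIONS --safe #-}
module Submission where

open import Defs
open import Data.Nat using (_≤_; s≤s; z≤n)
open import Data.Fin using (Fin; zero; suc)
open import Data.Fin.Properties using (suc-injective)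
open import Data.Product using (_×_; _,_)
open import Data.Sum using () renaming ([_,_] to case⊎)
open import Data.Empty using (⊥)
open import Data.Unit using (tt)
open import Relation.Nullary using (¬_; contradiction)
open import Relation.Binary.PropositionalEquality using (_≢_; refl; ≢-sym)
open import Function.Bundles using (Equivalence)

-- If the centre x lies in S, then for any two leaves u, v the path u x v is a
-- shortest u,v-path with the interior vertex x in S. So no two leaves are S-positionable,
-- hence no two leaves lie both in S or both outside S; but three leaves cannot pairwise
-- differ in membership of S.

Discordant : Set → Set → Set
Discordant A B = ¬ (A × B) × ¬ (¬ A × ¬ B)

-- Holds without excluded middle, so membership in S need not be decidable.
no-three-pairwise-discordant : ∀ {A B C : Set} →
  Discordant A B → Discordant A C → Discordant B C → ⊥
no-three-pairwise-discordant {A} (¬ab , ¬¬a¬b) (¬ac , ¬¬a¬c) (¬bc , ¬¬b¬c) =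
  ¬¬a¬b (¬a , λ b → ¬¬a¬c (¬a , λ c → ¬bc (b , c)))
  where
  ¬a : ¬ A
  ¬a a = ¬¬b¬c ((λ b → ¬ab (a , b)) , (λ c → ¬ac (a , c)))

module _ {n} (G : Graph n) where

  adj⇒≢ : ∀ {u v} → Adj G u v → u ≢ v
  adj⇒≢ uv refl = irrefl G uv

  2≤walk-length : ∀ {u v k} → u ≢ v → ¬ Adj G u v → Walk G u v k → 2 ≤ k
  2≤walk-length u≢u _   [ _ ]          = contradiction refl u≢u
  2≤walk-length _   ¬uv (uv ∷ [ _ ])   = contradiction uv ¬uv
  2≤walk-length _   _   (_ ∷ (_ ∷ _))  = s≤s (s≤s z≤n)

  ¬positionable-via-common-neighbour : ∀ (S : VSet n) {u x v} → S x →
    u ≢ v → ¬ Adj G u v → Adj G u x → Adj G x v → ¬ Positionable G S u v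
  ¬positionable-via-common-neighbour S {u} {x} {v} Sx u≢v ¬uv ux xv pos =
    case⊎ (≢-sym (adj⇒≢ ux)) (adj⇒≢ xv)
          (pos 2 uxv (λ _ → 2≤walk-length u≢v ¬uv) x x∈uxv Sx)
    where
    uxv : Walk G u v 2
    uxv = ux ∷ (xv ∷ [ v ])
    x∈uxv : x ∈W uxv
    x∈uxv = there ux (here xv [ v ])

  dualGeneralPosition⇒discordant-common-neighbours : ∀ {S : VSet n} {u x v} →
    IsDualGeneralPosition G S → S x →
    u ≢ v → ¬ Adj G u v → Adj G u x → Adj G x v → Discordant (S u) (S v)
  dualGeneralPosition⇒discordant-common-neighbours {S} {u} {v = v} (gp , dgp) Sx u≢v ¬uv ux xv =
      (λ (Su , Sv) → ¬pos (gp _ _ u≢v Su Sv))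
    , (λ (¬Su , ¬Sv) → ¬pos (dgp _ _ u≢v ¬Su ¬Sv))
    where
    ¬pos : ¬ Positionable G S u v
    ¬pos = ¬positionable-via-common-neighbour S Sx u≢v ¬uv ux xv

mainTheorem8 : ∀ {n} (G : Graph n) (S : VSet n) → IsDualGeneralPosition G S →
    (x : Fin n) → IsK13Centre G x → ¬ S x
mainTheorem8 G S dual x (H , refl) Sx =
  no-three-pairwise-discordant (leaves-discordant {zero} {suc zero} λ ())
                               (leaves-discordant {zero} {suc (suc zero)} λ ())
                               (leaves-discordant {suc zero} {suc (suc zero)} λ ())
  where
  open InducedK13 H
  leaves-discordant : ∀ {i j} → i ≢ j → Discordant (S (f (suc i))) (S (f (suc j)))
  leaves-discordant {i} {j} i≢j =
    dualGeneralPosition⇒discordant-common-neighbours G dual Sx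
      (λ fi≡fj → i≢j (suc-injective (inj fi≡fj)))
      (Equivalence.to (pres (suc i) (suc j)))
      (Equivalence.from (pres (suc i) zero) tt)
      (Equivalence.from (pres zero (suc j)) tt)
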